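{- For every integer $n\ge 1$, let $K_n \mathbin{\triangleright} K_n$ denote the graph obtained from two disjoint complete graphs $K_n$ with vertex orderings $v_1,\ldots,v_n$ and $w_1,\ldots,w_n$ by adding, for all $i,j\in\{1,\ldots,n\}$, the edge $v_iw_j$ if and only if $i\ge j$. Then $K_n \mathbin{\triangleright} K_n$ has no induced subgraph isomorphic to any of $K_{1,3}$, $P_5$, $\operatorname{bull}$, $W_4$, and $\overline{BW_3}$.
   Context: Here $P_5$ is the path on $5$ vertices; $\operatorname{bull}$ is the graph consisting of a triangle together with two further vertices, each adjacent to exactly one vertex of the triangle, these two triangle vertices being distinct; $W_4$ is the wheel consisting of a $4$-cycle plus a vertex adjacent to all four cycle vertices; $\overline{BW_3}$ is the $7$-vertex graph consisting of two disjoint triangles $a_1a_2a_3$ and $b_1b_2b_3$, the edges $a_ib_i$ for $i=1,2,3$, and a further vertex adjacent to exactly $b_1,b_2,b_3$. -}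

module Defs where

open import Level using (0ℓ)
open import Data.Nat using (ℕ; suc; _≤_)
open import Data.Fin using (Fin; toℕ; zero; suc; #_)
open import Data.Sum using (_⊎_; inj₁; inj₂)
open import Data.Product using (_×_; _,_; Σ)
open import Data.List using (List; []; _∷_)
open import Data.List.Membership.Propositional using (_∈_)
open import Data.Empty using (⊥)
open import Relation.Binary.PropositionalEquality using (_≡_; _≢_)
open import Relation.Nullary using (¬_)
open import Function using (_⇔_)

record Graph : Set₁ where
  field
    V   : Set
    Adj : V → V → Set

open Graph public

fromEdges : (k : ℕ) → List (Fin k × Fin k) → Graph
fromEdges k es = record
  { V = Fin k
  ; Adj = λ a b → ((a , b) ∈ es) ⊎ ((b , a) ∈ es) }

record InducedSub (H G : Graph) : Set where
  field
    f         : V H → V G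
    injective : ∀ {a b} → f a ≡ f b → a ≡ b
    preserves : ∀ a b → Adj H a b ⇔ Adj G (f a) (f b)

Free : Graph → Graph → Set
Free H G = ¬ InducedSub H G

-- K_n ▷ K_n : vertices v_i = inj₁ i, w_j = inj₂ j (0-indexed, i,j < n);
-- v's form a clique, w's form a clique, and v_i w_j is an edge iff i ≥ j.
KnTriKn : ℕ → Graph
KnTriKn n = record { V = Fin n ⊎ Fin n ; Adj = adj }
  where
  adj : Fin n ⊎ Fin n → Fin n ⊎ Fin n → Set
  adj (inj₁ i) (inj₁ j) = i ≢ j
  adj (inj₂ i) (inj₂ j) = i ≢ j
  adj (inj₁ i) (inj₂ j) = toℕ j ≤ toℕ i
  adj (inj₂ j) (inj₁ i) = toℕ j ≤ toℕ i

K13 : Graph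
K13 = fromEdges 4 ((# 0 , # 1) ∷ (# 0 , # 2) ∷ (# 0 , # 3) ∷ [])

P5 : Graph
P5 = fromEdges 5 ((# 0 , # 1) ∷ (# 1 , # 2) ∷ (# 2 , # 3) ∷ (# 3 , # 4) ∷ [])

Bull : Graph
Bull = fromEdges 5 ((# 0 , # 1) ∷ (# 1 , # 2) ∷ (# 0 , # 2) ∷
                    (# 0 , # 3) ∷ (# 1 , # 4) ∷ [])

W4 : Graph
W4 = fromEdges 5 ((# 0 , # 1) ∷ (# 1 , # 2) ∷ (# 2 , # 3) ∷ (# 3 , # 0) ∷
                  (# 4 , # 0) ∷ (# 4 , # 1) ∷ (# 4 , # 2) ∷ (# 4 , # 3) ∷ [])

-- co-BW_3: triangles a1a2a3 = 0,1,2 and b1b2b3 = 3,4,5, edges a_i b_i,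
-- and vertex 6 adjacent to exactly b1,b2,b3.
coBW3 : Graph
coBW3 = fromEdges 7 ((# 0 , # 1) ∷ (# 1 , # 2) ∷ (# 0 , # 2) ∷
                     (# 3 , # 4) ∷ (# 4 , # 5) ∷ (# 3 , # 5) ∷
                     (# 0 , # 3) ∷ (# 1 , # 4) ∷ (# 2 , # 5) ∷
                     (# 6 , # 3) ∷ (# 6 , # 4) ∷ (# 6 , # 5) ∷ [])

-- Two distinct vertices of K_n ▷ K_n are non-adjacent only if they lie on
-- opposite sides, as v_i and w_j with i < j.  Hence:
--   * there is no independent set of three vertices (two of them would lie on
--     the same side and be adjacent), and
--   * there is no induced 4-cycle: its two diagonals would be non-adjacent
--     cross pairs v_i w_j (i < j) and v_k w_l (k < l), and the four cycle
--     edges then force l ≤ i < j ≤ k < l or the symmetric chain.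
-- Independent triples and induced 4-cycles are carried along induced
-- embeddings, so a graph containing one is not an induced subgraph of
-- K_n ▷ K_n.  Finally K_{1,3}, P_5 and the bull contain an independent
-- triple, while W_4 and co-BW_3 contain an induced 4-cycle; for these
-- finite graphs adjacency is decided by searching the edge list.
module Submission where

open import Defs
open import Data.Nat using (ℕ; _≥_; _≤_)
open import Data.Nat.Properties using (≰⇒>; ≤-trans; <⇒≤; <-≤-trans)
open import Data.Product using (_×_; _,_)
open import Data.Product.Properties using (≡-dec)
open import Data.Sum using (inj₁; inj₂)
open import Data.Fin using (Fin; toℕ; #_)
import Data.Fin.Properties as Fin
open import Data.List using (List)
import Data.List.Membership.DecPropositional as DecMembership
open import Data.Empty using (⊥)
open import Relation.Nullary using (¬_; Dec)
open import Relation.Nullary.Decidable using (_⊎-dec_; toWitness; toWitnessFalse; True; False)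
open import Relation.Binary.PropositionalEquality using (_≢_; cong)
open import Function using (Equivalence)

NonAdj : (G : Graph) → V G → V G → Set
NonAdj G x y = x ≢ y × ¬ Adj G x y

record IndependentTriple (G : Graph) : Set where
  constructor triple
  field
    x y z : V G
    xy    : NonAdj G x y
    yz    : NonAdj G y z
    xz    : NonAdj G x z

record InducedC4 (G : Graph) : Set where
  constructor cycle
  field
    a b c d : V G
    ab      : Adj G a b
    bc      : Adj G b c
    cd      : Adj G c d
    da      : Adj G d a
    ac      : NonAdj G a c
    bd      : NonAdj G b d

module Embedding {H G : Graph} (e : InducedSub H G) where
  open InducedSub e

  adj : ∀ {a b} → Adj H a b → Adj G (f a) (f b)
  adj = Equivalence.to (preserves _ _)

  nonAdj : ∀ {a b} → NonAdj H a b → NonAdj G (f a) (f b)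
  nonAdj (a≢b , ¬ab) = (λ fa≡fb → a≢b (injective fa≡fb))
                     , (λ fab → ¬ab (Equivalence.from (preserves _ _) fab))

  independentTriple : IndependentTriple H → IndependentTriple G
  independentTriple (triple x y z xy yz xz) =
    triple (f x) (f y) (f z) (nonAdj xy) (nonAdj yz) (nonAdj xz)

  inducedC4 : InducedC4 H → InducedC4 G
  inducedC4 (cycle a b c d ab bc cd da ac bd) =
    cycle (f a) (f b) (f c) (f d) (adj ab) (adj bc) (adj cd) (adj da)
          (nonAdj ac) (nonAdj bd)

free-by-triple : ∀ {H G} → IndependentTriple H → ¬ IndependentTriple G → Free H G
free-by-triple t noTriple e = noTriple (Embedding.independentTriple e t)

free-by-C4 : ∀ {H G} → InducedC4 H → ¬ InducedC4 G → Free H G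
free-by-C4 q noC4 e = noC4 (Embedding.inducedC4 e q)

adj? : ∀ k (es : List (Fin k × Fin k)) a b → Dec (Adj (fromEdges k es) a b)
adj? k es a b = (a , b) ∈? es ⊎-dec (b , a) ∈? es
  where open DecMembership (≡-dec Fin._≟_ Fin._≟_)

edge : ∀ {k es} a b → {True (adj? k es a b)} → Adj (fromEdges k es) a b
edge {k} {es} a b {t} = toWitness {a? = adj? k es a b} t

nonEdge : ∀ {k es} a b → {a ≢ b} → {False (adj? k es a b)} →
          NonAdj (fromEdges k es) a b
nonEdge {k} {es} a b {a≢b} {t} = a≢b , toWitnessFalse {a? = adj? k es a b} t

claw-triple : IndependentTriple K13
claw-triple = triple (# 1) (# 2) (# 3)
  (nonEdge (# 1) (# 2) {λ ()}) (nonEdge (# 2) (# 3) {λ ()}) (nonEdge (# 1) (# 3) {λ ()})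

path-triple : IndependentTriple P5
path-triple = triple (# 0) (# 2) (# 4)
  (nonEdge (# 0) (# 2) {λ ()}) (nonEdge (# 2) (# 4) {λ ()}) (nonEdge (# 0) (# 4) {λ ()})

bull-triple : IndependentTriple Bull
bull-triple = triple (# 2) (# 3) (# 4)
  (nonEdge (# 2) (# 3) {λ ()}) (nonEdge (# 3) (# 4) {λ ()}) (nonEdge (# 2) (# 4) {λ ()})

wheel-C4 : InducedC4 W4
wheel-C4 = cycle (# 0) (# 1) (# 2) (# 3)
  (edge (# 0) (# 1)) (edge (# 1) (# 2)) (edge (# 2) (# 3)) (edge (# 3) (# 0))
  (nonEdge (# 0) (# 2) {λ ()}) (nonEdge (# 1) (# 3) {λ ()})

coBW3-C4 : InducedC4 coBW3
coBW3-C4 = cycle (# 0) (# 1) (# 4) (# 3)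
  (edge (# 0) (# 1)) (edge (# 1) (# 4)) (edge (# 4) (# 3)) (edge (# 3) (# 0))
  (nonEdge (# 0) (# 4) {λ ()}) (nonEdge (# 1) (# 3) {λ ()})

module _ {n : ℕ} where

  data Cross : V (KnTriKn n) → V (KnTriKn n) → Set where
    v-w : ∀ i j → ¬ toℕ j ≤ toℕ i → Cross (inj₁ i) (inj₂ j)
    w-v : ∀ i j → ¬ toℕ j ≤ toℕ i → Cross (inj₂ j) (inj₁ i)

  nonAdj⇒cross : ∀ {x y} → NonAdj (KnTriKn n) x y → Cross x y
  nonAdj⇒cross {inj₁ i} {inj₁ j} (x≢y , ¬xy) with () ← ¬xy (λ i≡j → x≢y (cong inj₁ i≡j))
  nonAdj⇒cross {inj₂ i} {inj₂ j} (x≢y , ¬xy) with () ← ¬xy (λ i≡j → x≢y (cong inj₂ i≡j))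
  nonAdj⇒cross {inj₁ i} {inj₂ j} (_ , ¬xy) = v-w i j ¬xy
  nonAdj⇒cross {inj₂ j} {inj₁ i} (_ , ¬xy) = w-v i j ¬xy

  -- Three vertices cannot be pairwise on opposite sides.
  no-independent-triple : ¬ IndependentTriple (KnTriKn n)
  no-independent-triple (triple _ _ _ xy yz xz)
    with nonAdj⇒cross xy | nonAdj⇒cross yz | nonAdj⇒cross xz
  ... | v-w _ _ _ | w-v _ _ _ | ()
  ... | w-v _ _ _ | v-w _ _ _ | ()

  interleaving : ∀ {i j k l : ℕ} → l ≤ i → ¬ j ≤ i → j ≤ k → ¬ l ≤ k → ⊥
  interleaving l≤i j≰i j≤k l≰k = l≰k (≤-trans l≤i (<⇒≤ (<-≤-trans (≰⇒> j≰i) j≤k)))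

  -- Both diagonals of an induced 4-cycle would be cross pairs; in each of
  -- the four orientations two opposite cycle edges interleave.
  no-induced-C4 : ¬ InducedC4 (KnTriKn n)
  no-induced-C4 (cycle _ _ _ _ ab bc cd da ac bd)
    with nonAdj⇒cross ac | nonAdj⇒cross bd
  ... | v-w _ _ i<j | v-w _ _ k<l = interleaving da i<j bc k<l
  ... | v-w _ _ i<j | w-v _ _ k<l = interleaving ab i<j cd k<l
  ... | w-v _ _ i<j | v-w _ _ k<l = interleaving cd i<j ab k<l
  ... | w-v _ _ i<j | w-v _ _ k<l = interleaving bc i<j da k<l

lemma4p4 : (n : ℕ) → n ≥ 1 →
    Free K13 (KnTriKn n) × Free P5 (KnTriKn n) × Free Bull (KnTriKn n) ×
    Free W4 (KnTriKn n) × Free coBW3 (KnTriKn n)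
lemma4p4 n _ =
    free-by-triple claw-triple  no-independent-triple
  , free-by-triple path-triple  no-independent-triple
  , free-by-triple bull-triple  no-independent-triple
  , free-by-C4     wheel-C4     no-induced-C4
  , free-by-C4     coBW3-C4     no-induced-C4
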